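{- For every integer $r\ge3$, \[ \mathscr{P}_{B_r}^{H} (q) = q + 2 \left( \sum_{i=2}^{r-1} \mathscr{P}_{B_i}^{NH} (q) \right) - q^2 \left( \sum_{i=1}^{r-2} \sum_{j=1}^i \mathscr{P}_{B_j}^{NH} (q) \right) . \]
   Context: Type $B_n$ ($n\ge1$): with simple roots $\alpha_1,\dots,\alpha_n$, the positive roots are the nonhooked roots $\alpha_i+\cdots+\alpha_j$ ($1\le i\le j\le n$) and the hooked roots $\alpha_i+\cdots+\alpha_{j-1}+2\alpha_j+\cdots+2\alpha_n$ ($1\le i<j\le n$); the highest root is $\tilde\alpha=\alpha_1+2\alpha_2+\cdots+2\alpha_n$ (equal to $\alpha_1$ if $n=1$). A partition of $\tilde\alpha$ with $k$ parts is a multiset of $k$ positive roots (repetitions allowed) summing to $\tilde\alpha$. $\mathscr{P}^H_{B_n}(q)=\sum_kc_kq^k$ where $c_k$ is the number of partitions of $\tilde\alpha$ with $k$ parts in which one part is a hooked root; $\mathscr{P}^{NH}_{B_n}(q)=\sum_kd_kq^k$ where $d_k$ is the number of partitions of $\tilde\alpha$ with $k$ parts none of which is a hooked root. -}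

module Defs where

open import Data.Bool using (Bool; true; false; _∧_; _∨_; if_then_else_)
open import Data.Nat using (ℕ; zero; suc; _+_; _≤ᵇ_; _<ᵇ_; _≡ᵇ_)
open import Data.Fin using (Fin; toℕ)
open import Data.List using (List; []; _∷_; _++_; map; concatMap; filterᵇ; length; foldr)
open import Data.Bool.ListAction using (any)
open import Data.Vec using (Vec; tabulate; replicate; zipWith)
open import Data.Integer using (ℤ; +_) renaming (_+_ to _+ℤ_; _-_ to _-ℤ_; _*_ to _*ℤ_)
open import Data.Product using (_×_; _,_; proj₁; proj₂)
open import Data.List.Base using (allFin)

-- Simple roots α_1..α_n are indexed by Fin n
-- (Fin index t corresponds to α_{t+1}). A root is recorded by its
-- coefficient vector in the basis of simple roots, together with a flag
-- telling whether it is hooked.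

nonhookedCoeffs : (n : ℕ) → Fin n → Fin n → Vec ℕ n
nonhookedCoeffs n i j =
  tabulate λ t → if (toℕ i ≤ᵇ toℕ t) ∧ (toℕ t ≤ᵇ toℕ j) then 1 else 0

-- α_i + ... + α_{j-1} + 2α_j + ... + 2α_n  (i < j), coefficients
hookedCoeffs : (n : ℕ) → Fin n → Fin n → Vec ℕ n
hookedCoeffs n i j =
  tabulate λ t → if toℕ t <ᵇ toℕ i then 0
                 else (if toℕ t <ᵇ toℕ j then 1 else 2)

Root : ℕ → Set
Root n = Bool × Vec ℕ n

hooked : {n : ℕ} → Root n → Bool
hooked = proj₁

positiveRoots : (n : ℕ) → List (Root n)
positiveRoots n =
  concatMap (λ i → concatMap (λ j →
      (if toℕ i ≤ᵇ toℕ j then (false , nonhookedCoeffs n i j) ∷ [] else [])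
   ++ (if toℕ i <ᵇ toℕ j then (true , hookedCoeffs n i j) ∷ [] else []))
    (allFin n)) (allFin n)

highestRoot : (n : ℕ) → Vec ℕ n
highestRoot n = tabulate λ t → if toℕ t ≡ᵇ 0 then 1 else 2

-- Multisets of size k drawn (with repetition) from a list of distinct
-- elements; each multiset is listed exactly once (as a list that is
-- weakly increasing with respect to the order of the input list).

multisets : {A : Set} → List A → ℕ → List (List A)
multisets []       zero    = [] ∷ []
multisets []       (suc k) = []
multisets (x ∷ xs) zero    = [] ∷ []
multisets (x ∷ xs) (suc k) = map (x ∷_) (multisets (x ∷ xs) k) ++ multisets xs (suc k)

vecEqᵇ : {n : ℕ} → Vec ℕ n → Vec ℕ n → Bool
vecEqᵇ Vec.[] Vec.[] = true
vecEqᵇ (a Vec.∷ as) (b Vec.∷ bs) = (a ≡ᵇ b) ∧ vecEqᵇ as bs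

rootSum : {n : ℕ} → List (Root n) → Vec ℕ n
rootSum {n} = foldr (λ β acc → zipWith _+_ (proj₂ β) acc) (replicate n 0)

partitions : (n k : ℕ) → List (List (Root n))
partitions n k = filterᵇ (λ M → vecEqᵇ (rootSum M) (highestRoot n)) (multisets (positiveRoots n) k)

hasHooked : {n : ℕ} → List (Root n) → Bool
hasHooked = any hooked

noHooked : {n : ℕ} → List (Root n) → Bool
noHooked M = if hasHooked M then false else true

-- Polynomials in q with integer coefficients, as coefficient functions.

Poly : Set
Poly = ℕ → ℤ

PH : ℕ → Poly
PH n k = + length (filterᵇ hasHooked (partitions n k))

PNH : ℕ → Poly
PNH n k = + length (filterᵇ noHooked (partitions n k))

_⊕_ : Poly → Poly → Poly
(f ⊕ g) k = f k +ℤ g k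

_⊖_ : Poly → Poly → Poly
(f ⊖ g) k = f k -ℤ g k

zeroP : Poly
zeroP _ = + 0

qP : Poly
qP k = if k ≡ᵇ 1 then + 1 else + 0

_·_ : ℤ → Poly → Poly
(c · f) k = c *ℤ f k

q²· : Poly → Poly
q²· f zero = + 0
q²· f (suc zero) = + 0
q²· f (suc (suc k)) = f k

sumFrom : ℕ → ℕ → (ℕ → Poly) → Poly
sumFrom a zero    F = zeroP
sumFrom a (suc m) F = F a ⊕ sumFrom (suc a) m F

Σ[_⋯_] : ℕ → ℕ → (ℕ → Poly) → Poly
Σ[ a ⋯ b ] F = sumFrom a (suc b Data.Nat.∸ a) F

module Submission where

-- Write A_b = P^{NH}_{B_{b+1}} and H_b = P^H_{B_{b+1}}, sequences (in the rank b)
-- of polynomials in q with natural coefficients.  Classifying the partitions of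
-- the highest root by their part through α₁, and peeling off the first target
-- coordinates, gives the recursions
--   A_b = q (δ_b + q Σ_{i<b} A_i + (geo A)_b),
--   H_b = q ((geo δ)_b + q Σ_{i<b} H_i + (geo H)_b),
-- where (geo X)_b = Σ_{i<b} (1+q)^{b-1-i} X_i.  As geo is linear and commutes
-- with q and with Σ<, geo A solves the recursion of H; solutions of such causal
-- recursions are unique, so H = geo A, and a short induction evaluates geo A.

open import Data.Bool using (Bool; true; false; _∧_; _∨_; if_then_else_)
open import Data.Nat using (ℕ; zero; suc; _+_; _*_; _∸_; _≤_; _<_; z≤n; s≤s; _≡ᵇ_; _≤ᵇ_; _<ᵇ_)
open import Data.Nat.Properties using (≤-refl; m≤n+m; m+n∸n≡m; <⇒≤; m<n⇒m<1+n; n<1+n; m<1+n⇒m<n∨m≡n; +-assoc; +-comm; +-identityʳ; +-suc; suc-injective; m+n∸m≡n; +-commutativeSemigroup)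
open import Algebra.Properties.CommutativeSemigroup +-commutativeSemigroup using () renaming (interchange to +-interchange)
open import Data.Bool.Properties using (∧-identityʳ; ∧-zeroʳ; ∨-assoc; ∧-assoc)
open import Data.Nat.ListAction using (sum)
open import Data.Nat.ListAction.Properties using (sum-++)
open import Data.List as L using (List; []; _∷_; _++_; map; foldr; length; replicate; filterᵇ; concatMap; allFin)
open import Data.List.Properties using (map-tabulate; concatMap-cong; map-concatMap; map-id; foldr-++; map-++; map-∘; map-cong; map-cong-local)
open import Data.List.Relation.Unary.All using (All; []; _∷_)
open import Data.Product using (_×_; _,_; proj₁; proj₂; ∃; ∃₂)
open import Function using (_∘_)
open import Data.Empty using (⊥-elim)
open import Data.Sum using (inj₁; inj₂)
open import Data.Nat.Solver using (module +-*-Solver)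
open +-*-Solver using (solve; _:+_; _:*_; _:=_; con)
open import Relation.Binary.PropositionalEquality
open import Data.Fin using (Fin; toℕ) renaming (zero to fzero; suc to fsuc)
open import Data.Fin.Properties using (toℕ<n)
open import Data.Vec as V using (Vec; toList; zipWith)
open import Data.Vec.Properties using (tabulate-cong; toList-replicate)
open import Defs

∑ : {A : Set} → (A → ℕ) → List A → ℕ
∑ f xs = sum (map f xs)

module _ {A : Set} where

  ∑-++ : (f : A → ℕ) (xs ys : List A) → ∑ f (xs ++ ys) ≡ ∑ f xs + ∑ f ys
  ∑-++ f xs ys = trans (cong sum (map-++ f xs ys)) (sum-++ (map f xs) (map f ys))

  ∑-cong : {f g : A → ℕ} → (∀ x → f x ≡ g x) → (xs : List A) → ∑ f xs ≡ ∑ g xs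
  ∑-cong e xs = cong sum (map-cong e xs)

  ∑-congAll : {f g : A → ℕ} {xs : List A} → All (λ x → f x ≡ g x) xs → ∑ f xs ≡ ∑ g xs
  ∑-congAll ps = cong sum (map-cong-local ps)

  ∑-map : {B : Set} (f : B → ℕ) (g : A → B) (xs : List A) → ∑ f (map g xs) ≡ ∑ (f ∘ g) xs
  ∑-map f g xs = cong sum (sym (map-∘ xs))

  ∑-zero : {f : A → ℕ} → (∀ x → f x ≡ 0) → (xs : List A) → ∑ f xs ≡ 0
  ∑-zero e []       = refl
  ∑-zero e (x ∷ xs) = cong₂ _+_ (e x) (∑-zero e xs)

  ∑-+ : (f g : A → ℕ) (xs : List A) → ∑ (λ x → f x + g x) xs ≡ ∑ f xs + ∑ g xs
  ∑-+ f g []       = refl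
  ∑-+ f g (x ∷ xs) rewrite ∑-+ f g xs = +-interchange (f x) (g x) (∑ f xs) (∑ g xs)

-- ∑≤ K F = F 0 + F 1 + ⋯ + F K; it indexes a k-multiset of xs ++ ys by how
-- many of its elements come from xs.
∑≤ : ℕ → (ℕ → ℕ) → ℕ
∑≤ zero    F = F 0
∑≤ (suc K) F = F 0 + ∑≤ K (F ∘ suc)

∑≤-cong : ∀ K {F G : ℕ → ℕ} → (∀ a → F a ≡ G a) → ∑≤ K F ≡ ∑≤ K G
∑≤-cong zero    e = e 0
∑≤-cong (suc K) e = cong₂ _+_ (e 0) (∑≤-cong K (e ∘ suc))

∑≤-+ : ∀ K (F G : ℕ → ℕ) → ∑≤ K (λ a → F a + G a) ≡ ∑≤ K F + ∑≤ K G
∑≤-+ zero    F G = refl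
∑≤-+ (suc K) F G rewrite ∑≤-+ K (F ∘ suc) (G ∘ suc) = +-interchange (F 0) (G 0) _ _

∑≤-single : ∀ t K (F : ℕ → ℕ) → (∀ a → a ≢ t → F a ≡ 0) → ∑≤ (t + K) F ≡ F t
∑≤-single zero    zero    F h = refl
∑≤-single zero    (suc K) F h =
  trans (cong (F 0 +_) (∑≤-vanish K (λ a → h (suc a) (λ ())))) (+-identityʳ _)
  where
  ∑≤-vanish : ∀ K {G : ℕ → ℕ} → (∀ a → G a ≡ 0) → ∑≤ K G ≡ 0
  ∑≤-vanish zero    e = e 0
  ∑≤-vanish (suc K) e = cong₂ _+_ (e 0) (∑≤-vanish K (e ∘ suc))
∑≤-single (suc t) K F h =
  cong₂ _+_ (h 0 (λ ())) (∑≤-single t K (F ∘ suc) (λ a a≢t → h (suc a) (a≢t ∘ suc-injective)))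

∑≤-before : ∀ t K (F : ℕ → ℕ) → (∀ a → a ≢ t → F a ≡ 0) → K < t → ∑≤ K F ≡ 0
∑≤-before (suc t) zero    F h _         = h 0 (λ ())
∑≤-before (suc t) (suc K) F h (s≤s K<t) =
  cong₂ _+_ (h 0 (λ ())) (∑≤-before t K (F ∘ suc) (λ a a≢t → h (suc a) (a≢t ∘ suc-injective)) K<t)

module _ {A : Set} where

  multisets-zero : (xs : List A) → multisets xs 0 ≡ [] ∷ []
  multisets-zero []       = refl
  multisets-zero (x ∷ xs) = refl

  multisets-one : (xs : List A) → multisets xs 1 ≡ map (_∷ []) xs
  multisets-one []       = refl
  multisets-one (x ∷ xs) = cong ((x ∷ []) ∷_) (multisets-one xs)

  multisets-two : (x : A) (xs : List A) →
    multisets (x ∷ xs) 2 ≡ map (λ y → x ∷ y ∷ []) (x ∷ xs) ++ multisets xs 2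
  multisets-two x xs rewrite multisets-one xs =
    cong (λ z → (x ∷ x ∷ []) ∷ z ++ multisets xs 2) (sym (map-∘ xs))

  multisets-map : {B : Set} (g : A → B) (xs : List A) (k : ℕ) →
    multisets (map g xs) k ≡ map (map g) (multisets xs k)
  multisets-map g []       zero    = refl
  multisets-map g []       (suc k) = refl
  multisets-map g (x ∷ xs) zero    = refl
  multisets-map g (x ∷ xs) (suc k)
    rewrite multisets-map g (x ∷ xs) k | multisets-map g xs (suc k)
          | map-++ (map g) (map (x ∷_) (multisets (x ∷ xs) k)) (multisets xs (suc k))
          | sym (map-∘ {g = map g} {f = x ∷_} (multisets (x ∷ xs) k))
          = cong (_++ map (map g) (multisets xs (suc k))) (sym (map-∘ (multisets (x ∷ xs) k)))

  ∑-multisets-cong : (P : A → Set) {xs : List A} → All P xs → (k : ℕ) {f g : List A → ℕ} →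
    (∀ M → All P M → length M ≡ k → f M ≡ g M) → ∑ f (multisets xs k) ≡ ∑ g (multisets xs k)
  ∑-multisets-cong P []       zero    h = cong (_+ 0) (h [] [] refl)
  ∑-multisets-cong P []       (suc k) h = refl
  ∑-multisets-cong P (p ∷ ps) zero    h = cong (_+ 0) (h [] [] refl)
  ∑-multisets-cong P {x ∷ xs} (p ∷ ps) (suc k) {f} {g} h = begin
    ∑ f (map (x ∷_) Mx ++ Mxs)      ≡⟨ ∑-++ f (map (x ∷_) Mx) Mxs ⟩
    ∑ f (map (x ∷_) Mx) + ∑ f Mxs   ≡⟨ cong₂ _+_ withX (∑-multisets-cong P ps (suc k) h) ⟩
    ∑ g (map (x ∷_) Mx) + ∑ g Mxs   ≡⟨ ∑-++ g (map (x ∷_) Mx) Mxs ⟨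
    ∑ g (map (x ∷_) Mx ++ Mxs)      ∎
    where
    open ≡-Reasoning
    Mx Mxs : List (List A)
    Mx  = multisets (x ∷ xs) k
    Mxs = multisets xs (suc k)
    withX : ∑ f (map (x ∷_) Mx) ≡ ∑ g (map (x ∷_) Mx)
    withX = begin
      ∑ f (map (x ∷_) Mx)   ≡⟨ ∑-map f (x ∷_) Mx ⟩
      ∑ (f ∘ (x ∷_)) Mx     ≡⟨ ∑-multisets-cong P (p ∷ ps) k (λ M pM |M| → h (x ∷ M) (p ∷ pM) (cong suc |M|)) ⟩
      ∑ (g ∘ (x ∷_)) Mx     ≡⟨ ∑-map g (x ∷_) Mx ⟨
      ∑ g (map (x ∷_) Mx)   ∎

  splitSum : (List A → ℕ) → List A → List A → ℕ → ℕ → ℕ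
  splitSum f xs ys k a = ∑ (λ M → ∑ (λ N → f (M ++ N)) (multisets ys (k ∸ a))) (multisets xs a)

  ∑-multisets-++ : (xs ys : List A) (f : List A → ℕ) (k : ℕ) →
    ∑ f (multisets (xs ++ ys) k) ≡ ∑≤ k (splitSum f xs ys k)
  ∑-multisets-++ []       ys f zero    = sym (+-identityʳ _)
  ∑-multisets-++ []       ys f (suc k) =
    sym (trans (cong₂ _+_ (+-identityʳ _) (∑≤-before (suc k) k (λ _ → 0) (λ _ _ → refl) ≤-refl)) (+-identityʳ _))
  ∑-multisets-++ (x ∷ xs) ys f zero rewrite multisets-zero ys = sym (+-identityʳ _)
  ∑-multisets-++ (x ∷ xs) ys f (suc k) = begin
    ∑ f (map (x ∷_) (multisets (x ∷ xs ++ ys) k) ++ multisets (xs ++ ys) (suc k))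
      ≡⟨ ∑-++ f (map (x ∷_) (multisets (x ∷ xs ++ ys) k)) (multisets (xs ++ ys) (suc k)) ⟩
    ∑ f (map (x ∷_) (multisets (x ∷ xs ++ ys) k)) + ∑ f (multisets (xs ++ ys) (suc k))
      ≡⟨ cong₂ _+_ (trans (∑-map f (x ∷_) (multisets (x ∷ xs ++ ys) k)) (∑-multisets-++ (x ∷ xs) ys (f ∘ (x ∷_)) k))
                   (∑-multisets-++ xs ys f (suc k)) ⟩
    ∑≤ k withX + (splitSum f xs ys (suc k) 0 + ∑≤ k withoutX)
      ≡⟨ +-exchange (∑≤ k withX) (splitSum f xs ys (suc k) 0) (∑≤ k withoutX) ⟩
    splitSum f xs ys (suc k) 0 + (∑≤ k withX + ∑≤ k withoutX)
      ≡⟨ cong₂ _+_ noneFromXs (sym (∑≤-+ k withX withoutX)) ⟩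
    splitSum f (x ∷ xs) ys (suc k) 0 + ∑≤ k (λ a → withX a + withoutX a)
      ≡⟨ cong (splitSum f (x ∷ xs) ys (suc k) 0 +_) (∑≤-cong k (sym ∘ someFromXs)) ⟩
    ∑≤ (suc k) (splitSum f (x ∷ xs) ys (suc k))
      ∎
    where
    open ≡-Reasoning
    withX withoutX : ℕ → ℕ
    withX a    = splitSum (f ∘ (x ∷_)) (x ∷ xs) ys k a
    withoutX a = splitSum f xs ys (suc k) (suc a)
    +-exchange : ∀ a b c → a + (b + c) ≡ b + (a + c)
    +-exchange a b c = trans (sym (+-assoc a b c)) (trans (cong (_+ c) (+-comm a b)) (+-assoc b a c))
    noneFromXs : splitSum f xs ys (suc k) 0 ≡ splitSum f (x ∷ xs) ys (suc k) 0
    noneFromXs = cong (∑ (λ M → ∑ (λ N → f (M ++ N)) (multisets ys (suc k)))) (multisets-zero xs)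
    someFromXs : ∀ a → splitSum f (x ∷ xs) ys (suc k) (suc a) ≡ withX a + withoutX a
    someFromXs a = trans (∑-++ g (map (x ∷_) (multisets (x ∷ xs) a)) (multisets xs (suc a)))
                         (cong (_+ withoutX a) (∑-map g (x ∷_) (multisets (x ∷ xs) a)))
      where
      g : List A → ℕ
      g M = ∑ (λ N → f (M ++ N)) (multisets ys (k ∸ a))

-- Polynomials in q with natural coefficients, as coefficient sequences, and
-- sequences (X_b) of such polynomials; equalities are coefficientwise.
Polyℕ : Set
Polyℕ = ℕ → ℕ

Seq : Set
Seq = ℕ → Polyℕ

q·_ : Polyℕ → Polyℕ
(q· f) zero    = 0
(q· f) (suc k) = f k

q·-cong : ∀ {f g : Polyℕ} → (∀ k → f k ≡ g k) → ∀ k → (q· f) k ≡ (q· g) k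
q·-cong e zero    = refl
q·-cong e (suc k) = e k

q·-+ : ∀ (f g : Polyℕ) k → (q· (λ j → f j + g j)) k ≡ (q· f) k + (q· g) k
q·-+ f g zero    = refl
q·-+ f g (suc k) = refl

q·-zero : ∀ k → (q· (λ _ → 0)) k ≡ 0
q·-zero zero    = refl
q·-zero (suc k) = refl

δ : Seq
δ zero    zero    = 1
δ zero    (suc k) = 0
δ (suc b) k       = 0

Σ< : Seq → Seq
Σ< X zero    k = 0
Σ< X (suc b) k = Σ< X b k + X b k

-- (geo X)_b = Σ_{i<b} (1+q)^{b-1-i} X_i; on generating functions in y it is
-- multiplication by y / (1 - (1+q) y).
geo : Seq → Seq
geo X zero    k = 0
geo X (suc b) k = X b k + (geo X b k + (q· geo X b) k)

geo-cong : ∀ {X Y : Seq} → (∀ b k → X b k ≡ Y b k) → ∀ b k → geo X b k ≡ geo Y b k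
geo-cong e zero    k = refl
geo-cong e (suc b) k = cong₂ _+_ (e b k) (cong₂ _+_ (geo-cong e b k) (q·-cong (geo-cong e b) k))

geo-+ : ∀ (X Y : Seq) b k → geo (λ b k → X b k + Y b k) b k ≡ geo X b k + geo Y b k
geo-+ X Y zero    k = refl
geo-+ X Y (suc b) k
  rewrite geo-+ X Y b k | q·-cong (geo-+ X Y b) k | q·-+ (geo X b) (geo Y b) k =
  solve 6 (λ x y gx gy qx qy → (x :+ y) :+ ((gx :+ gy) :+ (qx :+ qy)) := (x :+ (gx :+ qx)) :+ (y :+ (gy :+ qy)))
        refl (X b k) (Y b k) (geo X b k) (geo Y b k) ((q· geo X b) k) ((q· geo Y b) k)

geo-q· : ∀ (X : Seq) b k → geo (λ b → q· X b) b k ≡ (q· geo X b) k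
geo-q· X zero    zero    = refl
geo-q· X zero    (suc k) = refl
geo-q· X (suc b) k
  rewrite geo-q· X b k | q·-cong (geo-q· X b) k
        | q·-+ (X b) (λ j → geo X b j + (q· geo X b) j) k | q·-+ (geo X b) (q· geo X b) k = refl

Σ<-geo-step : ∀ (X : Seq) b k →
  Σ< (geo X) (suc b) k ≡ Σ< X b k + (Σ< (geo X) b k + (q· Σ< (geo X) b) k)
Σ<-geo-step X zero    zero    = refl
Σ<-geo-step X zero    (suc k) = refl
Σ<-geo-step X (suc b) k =
  trans (cong (_+ geo X (suc b) k) (Σ<-geo-step X b k))
        (trans (solve 6 (λ s x g y h z → (s :+ (g :+ h)) :+ (x :+ (y :+ z)) := (s :+ x) :+ ((g :+ y) :+ (h :+ z)))
                        refl (Σ< X b k) (X b k) (Σ< (geo X) b k) (geo X b k) ((q· Σ< (geo X) b) k) ((q· geo X b) k))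
               (cong (λ u → Σ< X (suc b) k + (Σ< (geo X) (suc b) k + u)) (sym (q·-+ (Σ< (geo X) b) (geo X b) k))))

geo-Σ< : ∀ (X : Seq) b k → geo (Σ< X) b k ≡ Σ< (geo X) b k
geo-Σ< X zero    k = refl
geo-Σ< X (suc b) k =
  trans (cong₂ (λ u v → Σ< X b k + (u + v)) (geo-Σ< X b k) (q·-cong (geo-Σ< X b) k))
        (sym (Σ<-geo-step X b k))

-- The recursion satisfied by P^{NH} (with D = δ) and by P^H (with D = geo δ):
--   X_b = q (D_b + q Σ_{i<b} X_i + (geo X)_b).
rec : Seq → Seq → Seq
rec D X b = q· (λ k → D b k + ((q· Σ< X b) k + geo X b k))

geo-rec : ∀ (D X : Seq) b k → geo (rec D X) b k ≡ rec (geo D) (geo X) b k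
geo-rec D X b k = begin
  geo (λ b → q· (λ k → D b k + ((q· Σ< X b) k + geo X b k))) b k
    ≡⟨ geo-q· (λ b k → D b k + ((q· Σ< X b) k + geo X b k)) b k ⟩
  (q· geo (λ b k → D b k + ((q· Σ< X b) k + geo X b k)) b) k
    ≡⟨ q·-cong (λ j → trans (geo-+ D _ b j) (cong (geo D b j +_) (geo-+ (λ b → q· Σ< X b) (geo X) b j))) k ⟩
  (q· (λ j → geo D b j + (geo (λ b → q· Σ< X b) b j + geo (geo X) b j))) k
    ≡⟨ q·-cong (λ j → cong (λ u → geo D b j + (u + geo (geo X) b j))
                           (trans (geo-q· (Σ< X) b j) (q·-cong (geo-Σ< X b) j))) k ⟩
  rec (geo D) (geo X) b k
    ∎
  where open ≡-Reasoning

Below : ℕ → Seq → Seq → Set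
Below b X Y = ∀ i → i < b → ∀ k → X i k ≡ Y i k

Causal : (Seq → Seq) → Set
Causal Φ = ∀ {X Y} b → Below b X Y → ∀ k → Φ X b k ≡ Φ Y b k

fixedPoint-unique : ∀ {Φ} → Causal Φ → ∀ {X Y} →
  (∀ b k → X b k ≡ Φ X b k) → (∀ b k → Y b k ≡ Φ Y b k) → ∀ b k → X b k ≡ Y b k
fixedPoint-unique {Φ} causal {X} {Y} fixX fixY b = agreeBelow (suc b) b (n<1+n b)
  where
  agreeBelow : ∀ b → Below b X Y
  agreeBelow zero    i ()
  agreeBelow (suc b) i i<1+b k with m<1+n⇒m<n∨m≡n i<1+b
  ... | inj₁ i<b  = agreeBelow b i i<b k
  ... | inj₂ refl = trans (fixX i k) (trans (causal i (agreeBelow i) k) (sym (fixY i k)))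

Below-pred : ∀ {b X Y} → Below (suc b) X Y → Below b X Y
Below-pred below i i<b = below i (m<n⇒m<1+n i<b)

Σ<-causal : Causal Σ<
Σ<-causal zero    below k = refl
Σ<-causal (suc b) below k = cong₂ _+_ (Σ<-causal b (Below-pred below) k) (below b (n<1+n b) k)

geo-causal : Causal geo
geo-causal zero    below k = refl
geo-causal (suc b) below k =
  cong₂ _+_ (below b (n<1+n b) k)
            (cong₂ _+_ (geo-causal b (Below-pred below) k) (q·-cong (geo-causal b (Below-pred below)) k))

rec-causal : ∀ D → Causal (rec D)
rec-causal D b below =
  q·-cong (λ j → cong (D b j +_) (cong₂ _+_ (q·-cong (Σ<-causal b below) j) (geo-causal b below j)))

geo-solves-hooked : ∀ (A : Seq) → (∀ b k → A b k ≡ rec δ A b k) →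
  ∀ b k → geo A b k ≡ rec (geo δ) (geo A) b k
geo-solves-hooked A fixA b k = trans (geo-cong fixA b k) (geo-rec δ A b k)

-- Induction on m: (geo A)_{m+2} = A_{m+1} + (1+q)(geo A)_{m+1}, and the
-- recursion gives A_{m+1} = q² Σ_{i≤m} A_i + q (geo A)_{m+1}.
geo-identity : ∀ (A : Seq) → (∀ b k → A b k ≡ rec δ A b k) → ∀ m k →
  geo A (suc m) k + (q· q· Σ< (Σ< A) (suc m)) k ≡ (q· δ 0) k + 2 * Σ< (λ i → A (suc i)) m k
geo-identity A fixA zero zero             rewrite fixA 0 0 = refl
geo-identity A fixA zero (suc zero)       rewrite fixA 0 1 = refl
geo-identity A fixA zero (suc (suc k))    rewrite fixA 0 (suc (suc k)) = refl
geo-identity A fixA (suc m) k = begin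
  (a + (g + h)) + (q· q· (λ j → Σ< (Σ< A) (suc m) j + Σ< A (suc m) j)) k
    ≡⟨ cong ((a + (g + h)) +_) (trans (q·-cong (q·-+ (Σ< (Σ< A) (suc m)) (Σ< A (suc m))) k)
                                      (q·-+ (q· Σ< (Σ< A) (suc m)) (q· Σ< A (suc m)) k)) ⟩
  (a + (g + h)) + (t + s)
    ≡⟨ solve 5 (λ a g h t s → (a :+ (g :+ h)) :+ (t :+ s) := (a :+ (s :+ h)) :+ (g :+ t)) refl a g h t s ⟩
  (a + (s + h)) + (g + t)
    ≡⟨ cong₂ (λ u v → (a + u) + v) (sym a≡s+h) (geo-identity A fixA m k) ⟩
  (a + a) + (e + 2 * r)
    ≡⟨ solve 3 (λ a e r → (a :+ a) :+ (e :+ con 2 :* r) := e :+ con 2 :* (r :+ a)) refl a e r ⟩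
  e + 2 * (r + a)
    ∎
  where
  open ≡-Reasoning
  a g h s t e r : ℕ
  a = A (suc m) k
  g = geo A (suc m) k
  h = (q· geo A (suc m)) k
  s = (q· q· Σ< A (suc m)) k
  t = (q· q· Σ< (Σ< A) (suc m)) k
  e = (q· δ 0) k
  r = Σ< (λ i → A (suc i)) m k
  a≡s+h : a ≡ s + h
  a≡s+h = trans (fixA (suc m) k) (q·-+ (q· Σ< A (suc m)) (geo A (suc m)) k)

∧-interchange : ∀ a b c d → (a ∧ b) ∧ (c ∧ d) ≡ (a ∧ c) ∧ (b ∧ d)
∧-interchange true  true  c d = refl
∧-interchange true  false c d = sym (∧-zeroʳ c)
∧-interchange false b     c d = refl

<ᵇ-suc : ∀ x y → (x <ᵇ suc y) ≡ (x ≤ᵇ y)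
<ᵇ-suc zero    y = refl
<ᵇ-suc (suc x) y = refl

-- A root of B_n is encoded as its hook flag and
-- its list of coefficients on α₁, α₂, …; lists are compared up to trailing
-- zeros, so that the roots of B_n embed into B_{n+1} by prepending a zero.
Coeffs : Set
Coeffs = List ℕ

LRoot : Set
LRoot = Bool × Coeffs

rep : ℕ → ℕ → Coeffs
rep = replicate

addC : Coeffs → Coeffs → Coeffs
addC []       ys       = ys
addC (x ∷ xs) []       = x ∷ xs
addC (x ∷ xs) (y ∷ ys) = x + y ∷ addC xs ys

eqCᵇ : Coeffs → Coeffs → Bool
eqCᵇ []       []       = true
eqCᵇ []       (y ∷ ys) = (y ≡ᵇ 0) ∧ eqCᵇ [] ys
eqCᵇ (x ∷ xs) []       = (x ≡ᵇ 0) ∧ eqCᵇ xs []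
eqCᵇ (x ∷ xs) (y ∷ ys) = (x ≡ᵇ y) ∧ eqCᵇ xs ys

leCᵇ : Coeffs → Coeffs → Bool
leCᵇ []       t        = true
leCᵇ (x ∷ xs) []       = (x ≡ᵇ 0) ∧ leCᵇ xs []
leCᵇ (x ∷ xs) (y ∷ ys) = (x ≤ᵇ y) ∧ leCᵇ xs ys

subC : Coeffs → Coeffs → Coeffs
subC t        []       = t
subC []       (s ∷ ss) = []
subC (t ∷ ts) (s ∷ ss) = (t ∸ s) ∷ subC ts ss

private
  eqC-leC : ∀ xs → eqCᵇ xs [] ≡ leCᵇ xs []
  eqC-leC []       = refl
  eqC-leC (x ∷ xs) = cong ((x ≡ᵇ 0) ∧_) (eqC-leC xs)

  addC-[] : ∀ xs → addC xs [] ≡ xs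
  addC-[] []       = refl
  addC-[] (x ∷ xs) = refl

  subC-[] : ∀ xs → subC [] xs ≡ []
  subC-[] []       = refl
  subC-[] (x ∷ xs) = refl

  ≡ᵇ-as-≤ᵇ : ∀ x y → (x ≡ᵇ y) ≡ (x ≤ᵇ y) ∧ (y ∸ x ≡ᵇ 0)
  ≡ᵇ-as-≤ᵇ zero    zero    = refl
  ≡ᵇ-as-≤ᵇ zero    (suc y) = refl
  ≡ᵇ-as-≤ᵇ (suc x) zero    = refl
  ≡ᵇ-as-≤ᵇ (suc x) (suc y) rewrite <ᵇ-suc x y = ≡ᵇ-as-≤ᵇ x y

  +≡ᵇ0 : ∀ x z → (x + z ≡ᵇ 0) ≡ (x ≡ᵇ 0) ∧ (z ≡ᵇ 0)
  +≡ᵇ0 zero    z = refl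
  +≡ᵇ0 (suc x) z = refl

  +≡ᵇ : ∀ x z y → (x + z ≡ᵇ y) ≡ (x ≤ᵇ y) ∧ (z ≡ᵇ y ∸ x)
  +≡ᵇ zero    z y       = refl
  +≡ᵇ (suc x) z zero    = refl
  +≡ᵇ (suc x) z (suc y) rewrite <ᵇ-suc x y = +≡ᵇ x z y

-- s + X = t  iff  s ≤ t and X = t - s.  This is how a part is peeled off a
-- target vector.
addC-eq : ∀ s X t → eqCᵇ (addC s X) t ≡ leCᵇ s t ∧ eqCᵇ X (subC t s)
addC-eq []       X        t        = refl
addC-eq (x ∷ xs) []       []       rewrite eqC-leC xs = sym (∧-identityʳ _)
addC-eq (x ∷ xs) []       (y ∷ ys) =
  trans (cong₂ _∧_ (≡ᵇ-as-≤ᵇ x y) (trans (cong (λ z → eqCᵇ z ys) (sym (addC-[] xs))) (addC-eq xs [] ys)))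
        (∧-interchange (x ≤ᵇ y) (y ∸ x ≡ᵇ 0) (leCᵇ xs ys) (eqCᵇ [] (subC ys xs)))
addC-eq (x ∷ xs) (z ∷ zs) []       rewrite addC-eq xs zs [] | subC-[] xs | +≡ᵇ0 x z =
  ∧-interchange (x ≡ᵇ 0) (z ≡ᵇ 0) (leCᵇ xs []) (eqCᵇ zs [])
addC-eq (x ∷ xs) (z ∷ zs) (y ∷ ys) rewrite addC-eq xs zs ys | +≡ᵇ x z y =
  ∧-interchange (x ≤ᵇ y) (z ≡ᵇ y ∸ x) (leCᵇ xs ys) (eqCᵇ zs (subC ys xs))

-- The positive roots of B_n in list form.  Those of B_{n+1} through α₁ (all
-- with α₁-coefficient 1) come first; the others are the roots of B_n shifted
-- one place to the right.
shift : LRoot → LRoot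
shift (h , v) = (h , 0 ∷ v)

-- adds α₁ to a root of the shifted copy that starts at α₂
extend : LRoot → LRoot
extend (h , v) = (h , 1 ∷ v)

α₁ : ℕ → LRoot
α₁ n = (false , 1 ∷ rep n 0)

hook₁₂ : ℕ → LRoot
hook₁₂ n = (true , 1 ∷ 2 ∷ rep n 2)

through₁′ : ℕ → List LRoot
through₁′ zero    = []
through₁′ (suc n) = extend (α₁ n) ∷ hook₁₂ n ∷ map extend (through₁′ n)

through₁ : ℕ → List LRoot
through₁ n = α₁ n ∷ through₁′ n

roots : ℕ → List LRoot
roots zero    = []
roots (suc n) = through₁ n ++ map shift (roots n)

StartsWith1 : LRoot → Set
StartsWith1 r = ∃ λ s → proj₂ r ≡ 1 ∷ s

all-extend-start1 : ∀ xs → All StartsWith1 (map extend xs)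
all-extend-start1 []       = []
all-extend-start1 (x ∷ xs) = (proj₂ x , refl) ∷ all-extend-start1 xs

through₁′-start1 : ∀ n → All StartsWith1 (through₁′ n)
through₁′-start1 zero    = []
through₁′-start1 (suc n) = (_ , refl) ∷ (_ , refl) ∷ all-extend-start1 (through₁′ n)

through₁-start1 : ∀ n → All StartsWith1 (through₁ n)
through₁-start1 n = (_ , refl) ∷ through₁′-start1 n

bit : Bool → ℕ
bit true  = 1
bit false = 0

-- `matches h b`: the hook condition — at least one hooked part (h = true)
-- or none (h = false) — holds of a multiset whose `has a hooked part` flag is b.
matches : Bool → Bool → Bool
matches true  b = b
matches false b = if b then false else true

sumC : ℕ → List LRoot → Coeffs
sumC n = foldr (λ r acc → addC (proj₂ r) acc) (rep n 0)

hasHookᵇ : List LRoot → Bool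
hasHookᵇ = foldr (λ r b → proj₁ r ∨ b) false

indicator : ℕ → Coeffs → Bool → List LRoot → ℕ
indicator n t h M = bit (eqCᵇ (sumC n M) t ∧ matches h (hasHookᵇ M))

-- count n t h k: the number of k-multisets of roots of B_n summing to t and
-- satisfying the hook condition h.  (The coefficient of q^k in P^H / P^{NH}.)
count : ℕ → Coeffs → Bool → ℕ → ℕ
count n t h k = ∑ (indicator n t h) (multisets (roots n) k)

tails : List LRoot → Coeffs → Coeffs
tails A Y = foldr (λ r acc → addC (L.drop 1 (proj₂ r)) acc) Y A

-- completions m t h A k: the number of k-multisets B of roots of B_m such that
-- A together with (the shift of) B is a partition of the target with tail t.
completions : ℕ → Coeffs → Bool → List LRoot → ℕ → ℕ
completions m t h A k =
  ∑ (λ B → bit (eqCᵇ (tails A (sumC m B)) t ∧ matches h (hasHookᵇ A ∨ hasHookᵇ B))) (multisets (roots m) k)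

sumC-shift : ∀ n B → sumC (suc n) (map shift B) ≡ 0 ∷ sumC n B
sumC-shift n []            = refl
sumC-shift n ((h , v) ∷ B) rewrite sumC-shift n B = refl

sumC-through₁ : ∀ (A : List LRoot) Y → All StartsWith1 A →
  foldr (λ r acc → addC (proj₂ r) acc) (0 ∷ Y) A ≡ length A ∷ tails A Y
sumC-through₁ []                    Y []                = refl
sumC-through₁ ((h , .(1 ∷ s)) ∷ A) Y ((s , refl) ∷ ps) rewrite sumC-through₁ A Y ps = refl

hasHook-++ : ∀ A B → hasHookᵇ (A ++ B) ≡ hasHookᵇ A ∨ hasHookᵇ B
hasHook-++ []      B = refl
hasHook-++ (x ∷ A) B rewrite hasHook-++ A B = sym (∨-assoc (proj₁ x) (hasHookᵇ A) (hasHookᵇ B))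

hasHook-shift : ∀ B → hasHookᵇ (map shift B) ≡ hasHookᵇ B
hasHook-shift []            = refl
hasHook-shift ((h , v) ∷ B) rewrite hasHook-shift B = refl

indicator-split : ∀ n t₀ t h (A : List LRoot) B → All StartsWith1 A →
  indicator (suc n) (t₀ ∷ t) h (A ++ map shift B) ≡
  bit ((length A ≡ᵇ t₀) ∧ (eqCᵇ (tails A (sumC n B)) t ∧ matches h (hasHookᵇ A ∨ hasHookᵇ B)))
indicator-split n t₀ t h A B start1
  rewrite foldr-++ (λ r acc → addC (proj₂ r) acc) (rep (suc n) 0) A (map shift B)
        | sumC-shift n B | sumC-through₁ A (sumC n B) start1 | hasHook-++ A (map shift B) | hasHook-shift B
  = cong bit (∧-assoc (length A ≡ᵇ t₀) _ _)

module _ {X : Set} where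

  ∑-if : ∀ c (g : X → ℕ) xs → ∑ (λ x → if c then g x else 0) xs ≡ (if c then ∑ g xs else 0)
  ∑-if true  g xs = refl
  ∑-if false g xs = ∑-zero (λ _ → refl) xs

  ∑-guard : ∀ c (g : X → Bool) xs → ∑ (λ x → bit (c ∧ g x)) xs ≡ (if c then ∑ (bit ∘ g) xs else 0)
  ∑-guard true  g xs = refl
  ∑-guard false g xs = ∑-zero (λ _ → refl) xs

-- First-coordinate decomposition: a partition of t₀ ∷ t in B_{n+1} consists of
-- t₀ roots through α₁ and some shifted roots of B_n.  `byThrough₁ … K a`
-- counts those of size K with a parts through α₁ (none unless a = t₀).
byThrough₁ : ℕ → ℕ → Coeffs → Bool → ℕ → ℕ → ℕ
byThrough₁ n t₀ t h K a =
  if a ≡ᵇ t₀ then ∑ (λ A → completions n t h A (K ∸ a)) (multisets (through₁ n) a) else 0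

count-byThrough₁ : ∀ n t₀ t h K → count (suc n) (t₀ ∷ t) h K ≡ ∑≤ K (byThrough₁ n t₀ t h K)
count-byThrough₁ n t₀ t h K =
  trans (∑-multisets-++ (through₁ n) (map shift (roots n)) ind K) (∑≤-cong K byParts)
  where
  ind : List LRoot → ℕ
  ind = indicator (suc n) (t₀ ∷ t) h
  byParts : ∀ a → splitSum ind (through₁ n) (map shift (roots n)) K a ≡ byThrough₁ n t₀ t h K a
  byParts a = begin
    ∑ (λ A → ∑ (λ N → ind (A ++ N)) (multisets (map shift (roots n)) (K ∸ a))) (multisets (through₁ n) a)
      ≡⟨ ∑-cong unshift (multisets (through₁ n) a) ⟩
    ∑ (λ A → ∑ (λ B → ind (A ++ map shift B)) (multisets (roots n) (K ∸ a))) (multisets (through₁ n) a)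
      ≡⟨ ∑-multisets-cong StartsWith1 (through₁-start1 n) a guarded ⟩
    ∑ (λ A → if a ≡ᵇ t₀ then completions n t h A (K ∸ a) else 0) (multisets (through₁ n) a)
      ≡⟨ ∑-if (a ≡ᵇ t₀) (λ A → completions n t h A (K ∸ a)) (multisets (through₁ n) a) ⟩
    byThrough₁ n t₀ t h K a
      ∎
    where
    open ≡-Reasoning
    unshift : ∀ A → ∑ (λ N → ind (A ++ N)) (multisets (map shift (roots n)) (K ∸ a))
                  ≡ ∑ (λ B → ind (A ++ map shift B)) (multisets (roots n) (K ∸ a))
    unshift A = trans (cong (∑ (λ N → ind (A ++ N))) (multisets-map shift (roots n) (K ∸ a)))
                      (∑-map (λ N → ind (A ++ N)) (map shift) (multisets (roots n) (K ∸ a)))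
    guarded : ∀ A → All StartsWith1 A → length A ≡ a →
      ∑ (λ B → ind (A ++ map shift B)) (multisets (roots n) (K ∸ a)) ≡ (if a ≡ᵇ t₀ then completions n t h A (K ∸ a) else 0)
    guarded A start1 refl =
      trans (∑-cong (λ B → indicator-split n t₀ t h A B start1) (multisets (roots n) (K ∸ a)))
            (∑-guard (length A ≡ᵇ t₀) _ (multisets (roots n) (K ∸ a)))

private
  ≡ᵇ-refl : ∀ a → (a ≡ᵇ a) ≡ true
  ≡ᵇ-refl zero    = refl
  ≡ᵇ-refl (suc a) = ≡ᵇ-refl a

  ≢⇒≡ᵇ-false : ∀ a b → a ≢ b → (a ≡ᵇ b) ≡ false
  ≢⇒≡ᵇ-false zero    zero    a≢b = ⊥-elim (a≢b refl)
  ≢⇒≡ᵇ-false zero    (suc b) _   = refl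
  ≢⇒≡ᵇ-false (suc a) zero    _   = refl
  ≢⇒≡ᵇ-false (suc a) (suc b) a≢b = ≢⇒≡ᵇ-false a b (a≢b ∘ cong suc)

  byThrough₁-off : ∀ n t₀ t h K a → a ≢ t₀ → byThrough₁ n t₀ t h K a ≡ 0
  byThrough₁-off n t₀ t h K a a≢t₀ rewrite ≢⇒≡ᵇ-false a t₀ a≢t₀ = refl

count-peel : ∀ n t₀ t h k →
  count (suc n) (t₀ ∷ t) h (t₀ + k) ≡ ∑ (λ A → completions n t h A k) (multisets (through₁ n) t₀)
count-peel n t₀ t h k
  rewrite count-byThrough₁ n t₀ t h (t₀ + k)
        | ∑≤-single t₀ k (byThrough₁ n t₀ t h (t₀ + k)) (byThrough₁-off n t₀ t h (t₀ + k))
        | ≡ᵇ-refl t₀ | m+n∸m≡n t₀ k = refl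

count-few : ∀ n t₀ t h k → k < t₀ → count (suc n) (t₀ ∷ t) h k ≡ 0
count-few n t₀ t h k k<t₀ =
  trans (count-byThrough₁ n t₀ t h k) (∑≤-before t₀ k (byThrough₁ n t₀ t h k) (byThrough₁-off n t₀ t h k) k<t₀)

-- Peeling one part (hx , 1 ∷ s) off A.  If the part is hooked, the hook
-- condition is decided: every completion counts when h = true, none when
-- h = false.
afterPart : ℕ → Coeffs → Bool → Bool → List LRoot → ℕ → ℕ
afterPart m t h true  A k = if h then completions m t true A k + completions m t false A k else 0
afterPart m t h false A k = completions m t h A k

completions-cons : ∀ m t h hx s A k →
  completions m t h ((hx , 1 ∷ s) ∷ A) k ≡ (if leCᵇ s t then afterPart m (subC t s) h hx A k else 0)
completions-cons m t h hx s A k =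
  trans (∑-cong (λ B → cong (λ z → bit (z ∧ matches h ((hx ∨ hasHookᵇ A) ∨ hasHookᵇ B)))
                            (addC-eq s (tails A (sumC m B)) t))
                (multisets (roots m) k))
        (byCase (leCᵇ s t) hx h)
  where
  rest : List LRoot → Bool
  rest B = eqCᵇ (tails A (sumC m B)) (subC t s)
  hooks : List LRoot → Bool
  hooks B = hasHookᵇ A ∨ hasHookᵇ B
  split : ∀ e c → bit (e ∧ true) ≡ bit (e ∧ c) + bit (e ∧ matches false c)
  split true  true  = refl
  split true  false = refl
  split false c     = refl
  never : ∀ e → bit (e ∧ false) ≡ 0
  never true  = refl
  never false = refl
  byCase : ∀ l hx h → ∑ (λ B → bit ((l ∧ rest B) ∧ matches h ((hx ∨ hasHookᵇ A) ∨ hasHookᵇ B))) (multisets (roots m) k)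
                    ≡ (if l then afterPart m (subC t s) h hx A k else 0)
  byCase false hx    h     = ∑-zero (λ _ → refl) (multisets (roots m) k)
  byCase true  false h     = refl
  byCase true  true  false = ∑-zero (λ B → never (rest B)) (multisets (roots m) k)
  byCase true  true  true  =
    trans (∑-cong (λ B → split (rest B) (hooks B)) (multisets (roots m) k))
          (∑-+ (λ B → bit (rest B ∧ hooks B)) (λ B → bit (rest B ∧ matches false (hooks B))) (multisets (roots m) k))

count-0∷ : ∀ n t h k → count (suc n) (0 ∷ t) h k ≡ count n t h k
count-0∷ n t h k = trans (count-peel n 0 t h k) (+-identityʳ _)

completions-extend : ∀ n c t h (A : List LRoot) k → All StartsWith1 A → length A ≡ c →
  completions (suc n) (c ∷ t) h (map extend A) k ≡ completions n t h A k
completions-extend n .0 t h [] k [] refl = count-0∷ n t h k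
completions-extend n .(suc (length A)) t h ((hx , .(1 ∷ s)) ∷ A) k ((s , refl) ∷ ps) refl =
  trans (completions-cons (suc n) (suc (length A) ∷ t) h hx (1 ∷ s) (map extend A) k)
        (trans (cong (λ z → if leCᵇ s t then z else 0) (afterPart-extend hx h))
               (sym (completions-cons n t h hx s A k)))
  where
  IH : ∀ h → completions (suc n) (length A ∷ subC t s) h (map extend A) k ≡ completions n (subC t s) h A k
  IH h = completions-extend n (length A) (subC t s) h A k ps refl
  afterPart-extend : ∀ hx h → afterPart (suc n) (length A ∷ subC t s) h hx (map extend A) k ≡ afterPart n (subC t s) h hx A k
  afterPart-extend true  true  = cong₂ _+_ (IH true) (IH false)
  afterPart-extend true  false = refl
  afterPart-extend false h     = IH h

count-1∷ : ∀ n t h k → count (suc n) (1 ∷ t) h (suc k) ≡ ∑ (λ x → completions n t h (x ∷ []) k) (through₁ n)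
count-1∷ n t h k =
  trans (count-peel n 1 t h k)
        (trans (cong (∑ (λ A → completions n t h A k)) (multisets-one (through₁ n)))
               (∑-map (λ A → completions n t h A k) (_∷ []) (through₁ n)))

private
  leC-rep0 : ∀ n t → leCᵇ (rep n 0) t ≡ true
  leC-rep0 zero    t       = refl
  leC-rep0 (suc n) []      = leC-rep0 n []
  leC-rep0 (suc n) (y ∷ t) = leC-rep0 n t

  subC-rep0 : ∀ n t → subC t (rep n 0) ≡ t
  subC-rep0 zero    t       = refl
  subC-rep0 (suc n) []      = refl
  subC-rep0 (suc n) (y ∷ t) = cong (y ∷_) (subC-rep0 n t)

-- α₁ has zero tail, so as a part through α₁ it leaves the rest of the target
-- untouched.
completions-α₁ : ∀ m t h A k → completions m t h (α₁ m ∷ A) k ≡ completions m t h A k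
completions-α₁ m t h A k
  rewrite completions-cons m t h false (rep m 0) A k | leC-rep0 m t | subC-rep0 m t = refl

∑-completions-extend : ∀ n t h k (xs : List LRoot) → All StartsWith1 xs →
  ∑ (λ x → completions (suc n) (1 ∷ t) h (x ∷ []) k) (map extend xs) ≡ ∑ (λ x → completions n t h (x ∷ []) k) xs
∑-completions-extend n t h k xs start1 =
  trans (∑-map (λ x → completions (suc n) (1 ∷ t) h (x ∷ []) k) extend xs) (∑-congAll (each xs start1))
  where
  each : ∀ xs → All StartsWith1 xs → All (λ x → completions (suc n) (1 ∷ t) h (extend x ∷ []) k ≡ completions n t h (x ∷ []) k) xs
  each []       []       = []
  each (x ∷ xs) (p ∷ ps) = completions-extend n 1 t h (x ∷ []) k (p ∷ []) refl ∷ each xs ps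

-- Doubling: a leading 1, 1 in the target contributes a factor 1 + q.  (The
-- part through α₁ is either α₁ itself, leaving 1 ∷ t in the shifted copy, or
-- α₁ plus a part through α₂.)
count-1∷1∷ : ∀ n t h k → count (suc (suc n)) (1 ∷ 1 ∷ t) h k ≡ count (suc n) (1 ∷ t) h k + (q· count (suc n) (1 ∷ t) h) k
count-1∷1∷ n t h zero =
  trans (count-few (suc n) 1 (1 ∷ t) h 0 (s≤s z≤n)) (sym (cong (_+ 0) (count-few n 1 t h 0 (s≤s z≤n))))
count-1∷1∷ n t h (suc k) = begin
  count (suc (suc n)) (1 ∷ 1 ∷ t) h (suc k)
    ≡⟨ count-1∷ (suc n) (1 ∷ t) h k ⟩
  completions (suc n) (1 ∷ t) h (α₁ (suc n) ∷ []) k + (one (extend (α₁ n)) + (one (hook₁₂ n) + ∑ one (map extend (through₁′ n))))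
    ≡⟨ cong₂ _+_ (completions-α₁ (suc n) (1 ∷ t) h [] k)
                 (cong₂ _+_ (completions-extend n 1 t h (α₁ n ∷ []) k ((_ , refl) ∷ []) refl)
                            (cong₂ _+_ hookedFirst (∑-completions-extend n t h k (through₁′ n) (through₁′-start1 n)))) ⟩
  count (suc n) (1 ∷ t) h k + (completions n t h (α₁ n ∷ []) k + (0 + ∑ (λ x → completions n t h (x ∷ []) k) (through₁′ n)))
    ≡⟨ cong (count (suc n) (1 ∷ t) h k +_) (sym (count-1∷ n t h k)) ⟩
  count (suc n) (1 ∷ t) h k + count (suc n) (1 ∷ t) h (suc k)
    ≡⟨ +-comm (count (suc n) (1 ∷ t) h k) _ ⟩
  count (suc n) (1 ∷ t) h (suc k) + count (suc n) (1 ∷ t) h k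
    ∎
  where
  open ≡-Reasoning
  one : LRoot → ℕ
  one x = completions (suc n) (1 ∷ t) h (x ∷ []) k
  -- the hooked root α₁ + 2α₂ + ⋯ exceeds the target coordinate 1 at α₂
  hookedFirst : one (hook₁₂ n) ≡ 0
  hookedFirst = completions-cons (suc n) (1 ∷ t) h true (2 ∷ rep n 2) [] k

Through₁₂ : LRoot → Set
Through₁₂ y = ∃₂ λ c s → proj₂ y ≡ 1 ∷ suc c ∷ s

all-extend-through₁₂ : ∀ xs → All StartsWith1 xs → All Through₁₂ (map extend xs)
all-extend-through₁₂ []                      []                = []
all-extend-through₁₂ ((h , .(1 ∷ s)) ∷ xs) ((s , refl) ∷ ps) = (0 , s , refl) ∷ all-extend-through₁₂ xs ps

through₁′-through₁₂ : ∀ n → All Through₁₂ (through₁′ n)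
through₁′-through₁₂ zero    = []
through₁′-through₁₂ (suc n) = (0 , _ , refl) ∷ (1 , _ , refl) ∷ all-extend-through₁₂ (through₁′ n) (through₁′-start1 n)

completions-blocked : ∀ m t h y k → Through₁₂ y → completions m (0 ∷ t) h (y ∷ []) k ≡ 0
completions-blocked m t h (hy , .(1 ∷ suc c ∷ s)) k (c , s , refl) = completions-cons m (0 ∷ t) h hy (suc c ∷ s) [] k

∑-completions-blocked : ∀ m t h k ys → All Through₁₂ ys → ∑ (λ y → completions m (0 ∷ t) h (y ∷ []) k) ys ≡ 0
∑-completions-blocked m t h k []       []       = refl
∑-completions-blocked m t h k (y ∷ ys) (p ∷ ps) = cong₂ _+_ (completions-blocked m t h y k p) (∑-completions-blocked m t h k ys ps)

afterPart-blocked : ∀ m t h y k → Through₁₂ y → afterPart m (0 ∷ t) h true (y ∷ []) k ≡ 0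
afterPart-blocked m t true  y k p = cong₂ _+_ (completions-blocked m t true y k p) (completions-blocked m t false y k p)
afterPart-blocked m t false y k p = refl

private
  if-same : ∀ b (x : ℕ) → (if b then x else x) ≡ x
  if-same true  x = refl
  if-same false x = refl

-- With target 2, 2, t a hooked part α₁ + 2α₂ + ⋯ cannot be combined with any
-- second part through α₂, and α₁ + α₂ cannot be combined with it either.
hook₁₂-pairs : ∀ n t h k → ∑ (λ A → completions (suc n) (2 ∷ t) h A k) (multisets (hook₁₂ n ∷ map extend (through₁′ n)) 2)
                          ≡ ∑ (λ A → completions (suc n) (2 ∷ t) h A k) (multisets (map extend (through₁′ n)) 2)
hook₁₂-pairs n t h k =
  trans (cong (∑ F) (multisets-two H U))
        (trans (∑-++ F (map (λ y → H ∷ y ∷ []) (H ∷ U)) (multisets U 2))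
               (cong (_+ ∑ F (multisets U 2)) (withH (H ∷ U) ((1 , _ , refl) ∷ all-extend-through₁₂ (through₁′ n) (through₁′-start1 n)))))
  where
  F : List LRoot → ℕ
  F A = completions (suc n) (2 ∷ t) h A k
  H : LRoot
  H = hook₁₂ n
  U : List LRoot
  U = map extend (through₁′ n)
  withH : ∀ ys → All Through₁₂ ys → ∑ F (map (λ y → H ∷ y ∷ []) ys) ≡ 0
  withH []       []       = refl
  withH (y ∷ ys) (p ∷ ps) =
    cong₂ _+_ (trans (completions-cons (suc n) (2 ∷ t) h true (2 ∷ rep n 2) (y ∷ []) k)
                     (trans (cong (λ z → if leCᵇ (rep n 2) t then z else 0) (afterPart-blocked (suc n) (subC t (rep n 2)) h y k p))
                            (if-same (leCᵇ (rep n 2) t) 0)))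
              (withH ys ps)

-- Two parts through α₁, neither of them α₁: they are α₁ plus two parts
-- through α₂, i.e. a pair of parts through α₁ for the target 2, t in B_{n+1}.
twoParts-without-α₁ : ∀ n t h k →
  ∑ (λ A → completions (suc n) (2 ∷ t) h A k) (multisets (through₁′ (suc n)) 2) ≡ count (suc n) (2 ∷ t) h (suc (suc k))
twoParts-without-α₁ n t h k = begin
  ∑ F (multisets (u ∷ H ∷ U) 2)
    ≡⟨ cong (∑ F) (multisets-two u (H ∷ U)) ⟩
  ∑ F (map (λ y → u ∷ y ∷ []) (u ∷ H ∷ U) ++ multisets (H ∷ U) 2)
    ≡⟨ ∑-++ F (map (λ y → u ∷ y ∷ []) (u ∷ H ∷ U)) (multisets (H ∷ U) 2) ⟩
  ∑ F (map (λ y → u ∷ y ∷ []) (u ∷ H ∷ U)) + ∑ F (multisets (H ∷ U) 2)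
    ≡⟨ cong₂ _+_ (cong (λ z → F (u ∷ u ∷ []) + (z + ∑ F (map (λ y → u ∷ y ∷ []) U))) uH) (hook₁₂-pairs n t h k) ⟩
  ∑ F (map (λ y → u ∷ y ∷ []) (u ∷ U)) + ∑ F (multisets U 2)
    ≡⟨ ∑-++ F (map (λ y → u ∷ y ∷ []) (u ∷ U)) (multisets U 2) ⟨
  ∑ F (map (λ y → u ∷ y ∷ []) (u ∷ U) ++ multisets U 2)
    ≡⟨ cong (∑ F) (multisets-two u U) ⟨
  ∑ F (multisets (map extend (through₁ n)) 2)
    ≡⟨ trans (cong (∑ F) (multisets-map extend (through₁ n) 2)) (∑-map F (map extend) (multisets (through₁ n) 2)) ⟩
  ∑ (F ∘ map extend) (multisets (through₁ n) 2)
    ≡⟨ ∑-multisets-cong StartsWith1 (through₁-start1 n) 2 (λ M start1 |M| → completions-extend n 2 t h M k start1 |M|) ⟩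
  ∑ (λ A → completions n t h A k) (multisets (through₁ n) 2)
    ≡⟨ count-peel n 2 t h k ⟨
  count (suc n) (2 ∷ t) h (suc (suc k))
    ∎
  where
  open ≡-Reasoning
  F : List LRoot → ℕ
  F A = completions (suc n) (2 ∷ t) h A k
  u H : LRoot
  u = extend (α₁ n)
  H = hook₁₂ n
  U : List LRoot
  U = map extend (through₁′ n)
  uH : F (u ∷ H ∷ []) ≡ 0
  uH = trans (completions-cons (suc n) (2 ∷ t) h false (1 ∷ rep n 0) (H ∷ []) k)
             (trans (cong (λ z → if leCᵇ (rep n 0) t then z else 0)
                          (completions-cons (suc n) (1 ∷ subC t (rep n 0)) h true (2 ∷ rep n 2) [] k))
                    (if-same (leCᵇ (rep n 0) t) 0))

-- Two parts through α₁ with target 2, 2, t: either one of them is α₁ (leaving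
-- the target 1, 2, t) or neither is.
count-2∷2∷ : ∀ n t h k →
  count (suc (suc n)) (2 ∷ 2 ∷ t) h (suc (suc k)) ≡ count (suc n) (2 ∷ t) h (suc (suc k)) + count (suc (suc n)) (1 ∷ 2 ∷ t) h (suc k)
count-2∷2∷ n t h k = begin
  count (suc (suc n)) (2 ∷ 2 ∷ t) h (suc (suc k))
    ≡⟨ count-peel (suc n) 2 (2 ∷ t) h k ⟩
  ∑ F (multisets (a ∷ through₁′ (suc n)) 2)
    ≡⟨ trans (cong (∑ F) (multisets-two a (through₁′ (suc n)))) (∑-++ F (map (λ y → a ∷ y ∷ []) (through₁ (suc n))) _) ⟩
  ∑ F (map (λ y → a ∷ y ∷ []) (through₁ (suc n))) + ∑ F (multisets (through₁′ (suc n)) 2)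
    ≡⟨ cong₂ _+_ with-α₁ (twoParts-without-α₁ n t h k) ⟩
  count (suc (suc n)) (1 ∷ 2 ∷ t) h (suc k) + count (suc n) (2 ∷ t) h (suc (suc k))
    ≡⟨ +-comm (count (suc (suc n)) (1 ∷ 2 ∷ t) h (suc k)) _ ⟩
  count (suc n) (2 ∷ t) h (suc (suc k)) + count (suc (suc n)) (1 ∷ 2 ∷ t) h (suc k)
    ∎
  where
  open ≡-Reasoning
  F : List LRoot → ℕ
  F A = completions (suc n) (2 ∷ t) h A k
  a : LRoot
  a = α₁ (suc n)
  with-α₁ : ∑ F (map (λ y → a ∷ y ∷ []) (through₁ (suc n))) ≡ count (suc (suc n)) (1 ∷ 2 ∷ t) h (suc k)
  with-α₁ = trans (∑-map F (λ y → a ∷ y ∷ []) (through₁ (suc n)))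
                  (trans (∑-cong (λ y → completions-α₁ (suc n) (2 ∷ t) h (y ∷ []) k) (through₁ (suc n)))
                         (sym (count-1∷ (suc n) (2 ∷ t) h k)))

-- The partitions of the zero vector: only the empty one, which has no hooked
-- part.
δ[_] : Bool → Seq
δ[ true  ] b k = 0
δ[ false ]     = δ

count-empty : ∀ h k → count 0 [] h k ≡ δ[ h ] 0 k
count-empty true  zero    = refl
count-empty false zero    = refl
count-empty true  (suc k) = refl
count-empty false (suc k) = refl

count-zeros : ∀ n h k → count n (rep n 0) h k ≡ δ[ h ] 0 k
count-zeros zero    h k = count-empty h k
count-zeros (suc n) h k = trans (count-0∷ n (rep n 0) h k) (count-zeros n h k)

P₁₀ : Bool → ℕ → ℕ → Polyℕ
P₁₀ h c z k = count (c + z) (rep c 1 ++ rep z 0) h k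

-- A single 1: the only partition is α₁ itself.
P₁₀-one : ∀ h z k → P₁₀ h 1 z k ≡ (q· δ[ h ] 0) k
P₁₀-one h z zero    = count-few z 1 (rep z 0) h 0 (s≤s z≤n)
P₁₀-one h z (suc k) =
  trans (count-1∷ z (rep z 0) h k)
        (trans (cong₂ _+_ (completions-α₁ z (rep z 0) h [] k) (others z))
               (trans (+-identityʳ _) (count-zeros z h k)))
  where
  others : ∀ z → ∑ (λ x → completions z (rep z 0) h (x ∷ []) k) (through₁′ z) ≡ 0
  others zero    = refl
  others (suc z) = ∑-completions-blocked (suc z) (rep z 0) h k (through₁′ (suc z)) (through₁′-through₁₂ (suc z))

P₁₀-doubling : ∀ h c z k → P₁₀ h (suc (suc c)) z k ≡ P₁₀ h (suc c) z k + (q· P₁₀ h (suc c) z) k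
P₁₀-doubling h c z k = count-1∷1∷ (c + z) (rep c 1 ++ rep z 0) h k

P₁₀-hooked : ∀ c z k → P₁₀ true c z k ≡ 0
P₁₀-hooked zero          z k       = count-zeros z true k
P₁₀-hooked (suc zero)    z zero    = P₁₀-one true z zero
P₁₀-hooked (suc zero)    z (suc k) = P₁₀-one true z (suc k)
P₁₀-hooked (suc (suc c)) z zero    = trans (P₁₀-doubling true c z zero) (cong (_+ 0) (P₁₀-hooked (suc c) z zero))
P₁₀-hooked (suc (suc c)) z (suc k) =
  trans (P₁₀-doubling true c z (suc k)) (cong₂ _+_ (P₁₀-hooked (suc c) z (suc k)) (P₁₀-hooked (suc c) z k))

-- ones c: the common value of P₁₀ false c z for all z, namely 1, q, q(1+q), q(1+q)², …
ones : ℕ → Polyℕ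
ones zero          = δ 0
ones (suc zero)    = q· δ 0
ones (suc (suc c)) k = ones (suc c) k + (q· ones (suc c)) k

P₁₀-ones : ∀ c z k → P₁₀ false c z k ≡ ones c k
P₁₀-ones zero          z k = count-zeros z false k
P₁₀-ones (suc zero)    z k = P₁₀-one false z k
P₁₀-ones (suc (suc c)) z k =
  trans (P₁₀-doubling false c z k) (cong₂ _+_ (P₁₀-ones (suc c) z k) (q·-cong (P₁₀-ones (suc c) z) k))

-- P₁₂ h a b: partitions of (1^a, 2^b) in B_{a+b}.  P^{NH}_{B_{b+1}} and
-- P^H_{B_{b+1}} are P₁₂ false 1 b and P₁₂ true 1 b.
P₁₂ : Bool → ℕ → ℕ → Polyℕ
P₁₂ h a b k = count (a + b) (rep a 1 ++ rep b 2) h k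

P₁₂-doubling : ∀ h a b k → P₁₂ h (suc (suc a)) b k ≡ P₁₂ h (suc a) b k + (q· P₁₂ h (suc a) b) k
P₁₂-doubling h a b k = count-1∷1∷ (a + b) (rep a 1 ++ rep b 2) h k

-- The vectors (2^b): the recursion P₁₂ h 0 (b+2) = P₁₂ h 0 (b+1) + q P₁₂ h 1 (b+1)
-- holds for k ≥ 2 by count-2∷2∷ and trivially below, where both sides vanish.
P₁₂-twos-step : ∀ h b k → P₁₂ h 0 (suc (suc b)) k ≡ P₁₂ h 0 (suc b) k + (q· P₁₂ h 1 (suc b)) k
P₁₂-twos-step h b zero =
  trans (count-few (suc b) 2 (2 ∷ rep b 2) h 0 (s≤s z≤n)) (sym (cong (_+ 0) (count-few b 2 (rep b 2) h 0 (s≤s z≤n))))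
P₁₂-twos-step h b (suc zero) =
  trans (count-few (suc b) 2 (2 ∷ rep b 2) h 1 (s≤s (s≤s z≤n)))
        (sym (cong₂ _+_ (count-few b 2 (rep b 2) h 1 (s≤s (s≤s z≤n))) (count-few (suc b) 1 (2 ∷ rep b 2) h 0 (s≤s z≤n))))
P₁₂-twos-step h b (suc (suc k)) = count-2∷2∷ b (rep b 2) h k

-- The vector (2) in B_1: only α₁ + α₁.
P₁₂-two : ∀ h k → P₁₂ h 0 1 k ≡ (q· q· δ[ h ] 0) k
P₁₂-two h zero          = count-few 0 2 [] h 0 (s≤s z≤n)
P₁₂-two h (suc zero)    = count-few 0 2 [] h 1 (s≤s (s≤s z≤n))
P₁₂-two h (suc (suc k)) = trans (count-peel 0 2 [] h k) (trans (+-identityʳ _) (count-empty h k))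

-- Sums along the first parts through α₁ of a partition of (1, 2^b): the part
-- α₁ + ⋯ + α_{c+1} leaves (1^{c+1}, 2^{b-c-1}); the hooked part
-- α₁ + ⋯ + α_c + 2α_{c+1} + ⋯ leaves (1^c, 0^{b-c}) and is allowed only when
-- h = true.
-- extend^ c x = α₁ + ⋯ + α_c + (x shifted c places)
extend^ : ℕ → LRoot → LRoot
extend^ zero    x = x
extend^ (suc c) x = extend^ c (extend x)

diag : Bool → ℕ → ℕ → Polyℕ
diag h c zero    k = 0
diag h c (suc n) k = P₁₂ h (suc c) n k + diag h (suc c) n k

from : ℕ → ℕ → Seq → Polyℕ
from c zero    X k = 0
from c (suc n) X k = X c k + from (suc c) n X k

mask : Bool → ℕ → ℕ
mask h x = if h then x else 0

private
  rep-1∷ : ∀ c (v : Coeffs) → rep c 1 ++ 1 ∷ v ≡ 1 ∷ rep c 1 ++ v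
  rep-1∷ zero    v = refl
  rep-1∷ (suc c) v = cong (1 ∷_) (rep-1∷ c v)

  extend^-through₁ : ∀ c hx v → extend^ c (hx , 1 ∷ v) ≡ (hx , 1 ∷ (rep c 1 ++ v))
  extend^-through₁ zero    hx v = refl
  extend^-through₁ (suc c) hx v = trans (extend^-through₁ c hx (1 ∷ v)) (cong (λ w → (hx , 1 ∷ w)) (rep-1∷ c v))

  rep-+ : ∀ a b (x : ℕ) → rep (a + b) x ≡ rep a x ++ rep b x
  rep-+ zero    b x = refl
  rep-+ (suc a) b x = cong (x ∷_) (rep-+ a b x)

  leC-ones-twos : ∀ c X Y → leCᵇ (rep c 1 ++ X) (rep c 2 ++ Y) ≡ leCᵇ X Y
  leC-ones-twos zero    X Y = refl
  leC-ones-twos (suc c) X Y = leC-ones-twos c X Y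

  subC-twos-ones : ∀ c X Y → subC (rep c 2 ++ Y) (rep c 1 ++ X) ≡ rep c 1 ++ subC Y X
  subC-twos-ones zero    X Y = refl
  subC-twos-ones (suc c) X Y = cong (1 ∷_) (subC-twos-ones c X Y)

  leC-twos : ∀ n → leCᵇ (rep n 2) (rep n 2) ≡ true
  leC-twos zero    = refl
  leC-twos (suc n) = leC-twos n

  subC-twos : ∀ n → subC (rep n 2) (rep n 2) ≡ rep n 0
  subC-twos zero    = refl
  subC-twos (suc n) = cong (0 ∷_) (subC-twos n)

-- Single parts through α₁ against the tail target 2^m (m = c + n): the c-fold
-- extensions of through₁′ n contribute diag h c n (the nonhooked parts) and,
-- when h = true, ones c + ⋯ + ones (c+n-1) (the hooked parts).
firstParts : ∀ h k c n m → c + n ≡ m →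
  ∑ (λ x → completions m (rep m 2) h (x ∷ []) k) (map (extend^ c) (through₁′ n)) ≡ diag h c n k + mask h (from c n ones k)
firstParts true  k c zero m e = refl
firstParts false k c zero m e = refl
firstParts h k c (suc n) .(c + suc n) refl =
  trans (cong₂ _+_ nonhookedPart (cong₂ _+_ hookedPart later)) (regroup h)
  where
  m : ℕ
  m = c + suc n
  nonhookedPart : completions m (rep m 2) h (extend^ c (extend (α₁ n)) ∷ []) k ≡ P₁₂ h (suc c) n k
  nonhookedPart
    rewrite extend^-through₁ c false (1 ∷ rep n 0) | completions-cons m (rep m 2) h false (rep c 1 ++ 1 ∷ rep n 0) [] k
          | rep-+ c (suc n) 2 | leC-ones-twos c (1 ∷ rep n 0) (2 ∷ rep n 2) | leC-rep0 n (rep n 2)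
          | subC-twos-ones c (1 ∷ rep n 0) (2 ∷ rep n 2) | subC-rep0 n (rep n 2) | rep-1∷ c (rep n 2)
    = cong (λ z → count z (1 ∷ rep c 1 ++ rep n 2) h k) (+-suc c n)
  hookedCounts : completions m (rep m 2) h (extend^ c (hook₁₂ n) ∷ []) k ≡ mask h (P₁₀ true c (suc n) k + P₁₀ false c (suc n) k)
  hookedCounts
    rewrite extend^-through₁ c true (2 ∷ rep n 2) | completions-cons m (rep m 2) h true (rep c 1 ++ 2 ∷ rep n 2) [] k
          | rep-+ c (suc n) 2 | leC-ones-twos c (2 ∷ rep n 2) (2 ∷ rep n 2) | leC-twos n
          | subC-twos-ones c (2 ∷ rep n 2) (2 ∷ rep n 2) | subC-twos n = refl
  hookedPart : completions m (rep m 2) h (extend^ c (hook₁₂ n) ∷ []) k ≡ mask h (ones c k)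
  hookedPart = trans hookedCounts (cong (mask h) (cong₂ _+_ (P₁₀-hooked c (suc n) k) (P₁₀-ones c (suc n) k)))
  later : ∑ (λ x → completions m (rep m 2) h (x ∷ []) k) (map (extend^ c) (map extend (through₁′ n)))
          ≡ diag h (suc c) n k + mask h (from (suc c) n ones k)
  later = trans (cong (∑ (λ x → completions m (rep m 2) h (x ∷ []) k)) (sym (map-∘ (through₁′ n))))
                (firstParts h k (suc c) n m (sym (+-suc c n)))
  regroup : ∀ h → P₁₂ h (suc c) n k + (mask h (ones c k) + (diag h (suc c) n k + mask h (from (suc c) n ones k)))
                  ≡ diag h c (suc n) k + mask h (from c (suc n) ones k)
  regroup true  = solve 4 (λ a b c d → a :+ (b :+ (c :+ d)) := (a :+ c) :+ (b :+ d)) refl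
                          (P₁₂ true (suc c) n k) (ones c k) (diag true (suc c) n k) (from (suc c) n ones k)
  regroup false = solve 2 (λ a c → a :+ (con 0 :+ (c :+ con 0)) := (a :+ c) :+ con 0) refl
                          (P₁₂ false (suc c) n k) (diag false (suc c) n k)

-- The basic recursion: choosing the part through α₁ of a partition of
-- (1, 2^b) gives P₁₂ h 1 b = q (P₁₂ h 0 b + diag h 0 b + [h] Σ_{c<b} ones c).
P₁₂-first : ∀ h b k → P₁₂ h 1 b k ≡ (q· (λ j → P₁₂ h 0 b j + (diag h 0 b j + mask h (from 0 b ones j)))) k
P₁₂-first h b zero    = count-few b 1 (rep b 2) h 0 (s≤s z≤n)
P₁₂-first h b (suc k) =
  trans (count-1∷ b (rep b 2) h k)
        (cong₂ _+_ (completions-α₁ b (rep b 2) h [] k)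
                   (trans (cong (∑ (λ x → completions b (rep b 2) h (x ∷ []) k)) (sym (map-id (through₁′ b))))
                          (firstParts h k 0 b b refl)))

-- The diagonal sums are geo of P₁₂ h 1, because each P₁₂ h (c+1) … gains a
-- factor 1 + q as c grows (doubling).
diag-doubling : ∀ h c n k → diag h (suc c) n k ≡ diag h c n k + (q· diag h c n) k
diag-doubling h c zero    k = sym (q·-zero k)
diag-doubling h c (suc n) k =
  trans (cong₂ _+_ (P₁₂-doubling h c n k) (diag-doubling h (suc c) n k))
        (trans (+-interchange (P₁₂ h (suc c) n k) ((q· P₁₂ h (suc c) n) k) (diag h (suc c) n k) ((q· diag h (suc c) n) k))
               (cong ((P₁₂ h (suc c) n k + diag h (suc c) n k) +_) (sym (q·-+ (P₁₂ h (suc c) n) (diag h (suc c) n) k))))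

diag-geo : ∀ h b k → diag h 0 b k ≡ geo (P₁₂ h 1) b k
diag-geo h zero    k = refl
diag-geo h (suc b) k =
  cong (P₁₂ h 1 b k +_) (trans (diag-doubling h 0 b k) (cong₂ _+_ (diag-geo h b k) (q·-cong (diag-geo h b) k)))

from-snoc : ∀ c n (X : Seq) k → from c (suc n) X k ≡ from c n X k + X (c + n) k
from-snoc c zero    X k = trans (+-identityʳ _) (cong (λ i → X i k) (sym (+-identityʳ c)))
from-snoc c (suc n) X k =
  trans (cong (X c k +_) (from-snoc (suc c) n X k))
        (trans (sym (+-assoc (X c k) _ _)) (cong (λ i → X c k + from (suc c) n X k + X i k) (sym (+-suc c n))))

from-Σ< : ∀ n (X : Seq) k → from 0 n X k ≡ Σ< X n k
from-Σ< zero    X k = refl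
from-Σ< (suc n) X k = trans (from-snoc 0 n X k) (cong (_+ X n k) (from-Σ< n X k))

from-shift : ∀ c n (X : Seq) k → from (suc c) n X k ≡ from c n (λ i → X (suc i)) k
from-shift c zero    X k = refl
from-shift c (suc n) X k = cong (X (suc c) k +_) (from-shift (suc c) n X k)

ones-geo : ∀ c k → ones c k ≡ δ c k + (q· geo δ c) k
ones-geo zero          zero          = refl
ones-geo zero          (suc k)       = refl
ones-geo (suc zero)    zero          = refl
ones-geo (suc zero)    (suc zero)    = refl
ones-geo (suc zero)    (suc (suc k)) = refl
ones-geo (suc (suc c)) k =
  trans (cong₂ _+_ (ones-geo (suc c) k) (q·-cong (ones-geo (suc c)) k))
        (sym (q·-+ (geo δ (suc c)) (q· geo δ (suc c)) k))

hookedFirst-geo : ∀ b k → from 0 b ones k ≡ geo δ b k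
hookedFirst-geo b k = trans (from-Σ< b ones k) (Σ<-ones b)
  where
  Σ<-ones : ∀ b → Σ< ones b k ≡ geo δ b k
  Σ<-ones zero    = refl
  Σ<-ones (suc b) =
    trans (cong₂ _+_ (Σ<-ones b) (ones-geo b k))
          (solve 3 (λ g d h → g :+ (d :+ h) := d :+ (g :+ h)) refl (geo δ b k) (δ b k) ((q· geo δ b) k))

P₁₂-twos : ∀ h b k → P₁₂ h 0 b k ≡ δ[ h ] b k + (q· Σ< (P₁₂ h 1) b) k
P₁₂-twos h zero          k = trans (count-empty h k) (sym (trans (cong (δ[ h ] 0 k +_) (q·-zero k)) (+-identityʳ _)))
P₁₂-twos h (suc zero)    k = trans (P₁₂-two h k) (sym (cong₂ _+_ (δ[]-suc h 0 k) (q·-cong (P₁₀-one h 0) k)))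
  where
  δ[]-suc : ∀ h b k → δ[ h ] (suc b) k ≡ 0
  δ[]-suc true  b k = refl
  δ[]-suc false b k = refl
P₁₂-twos h (suc (suc b)) k =
  trans (P₁₂-twos-step h b k)
        (trans (cong (_+ (q· P₁₂ h 1 (suc b)) k) (P₁₂-twos h (suc b) k)) (regroup h))
  where
  regroup : ∀ h → δ[ h ] (suc b) k + (q· Σ< (P₁₂ h 1) (suc b)) k + (q· P₁₂ h 1 (suc b)) k
                  ≡ δ[ h ] (suc (suc b)) k + (q· Σ< (P₁₂ h 1) (suc (suc b))) k
  regroup true  = sym (q·-+ (Σ< (P₁₂ true 1) (suc b)) (P₁₂ true 1 (suc b)) k)
  regroup false = sym (q·-+ (Σ< (P₁₂ false 1) (suc b)) (P₁₂ false 1 (suc b)) k)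

P₁₂-recursion : ∀ h b k →
  P₁₂ h 1 b k ≡ (q· (λ j → (δ[ h ] b j + (q· Σ< (P₁₂ h 1) b) j) + (geo (P₁₂ h 1) b j + mask h (geo δ b j)))) k
P₁₂-recursion h b k =
  trans (P₁₂-first h b k)
        (q·-cong (λ j → cong₂ _+_ (P₁₂-twos h b j) (cong₂ _+_ (diag-geo h b j) (cong (mask h) (hookedFirst-geo b j)))) k)

nonhooked-rec : ∀ b k → P₁₂ false 1 b k ≡ rec δ (P₁₂ false 1) b k
nonhooked-rec b k =
  trans (P₁₂-recursion false b k)
        (q·-cong (λ j → solve 3 (λ d s g → (d :+ s) :+ (g :+ con 0) := d :+ (s :+ g)) refl
                                (δ b j) ((q· Σ< (P₁₂ false 1) b) j) (geo (P₁₂ false 1) b j)) k)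

hooked-rec : ∀ b k → P₁₂ true 1 b k ≡ rec (geo δ) (P₁₂ true 1) b k
hooked-rec b k =
  trans (P₁₂-recursion true b k)
        (q·-cong (λ j → solve 3 (λ s g d → (con 0 :+ s) :+ (g :+ d) := d :+ (s :+ g)) refl
                                ((q· Σ< (P₁₂ true 1) b) j) (geo (P₁₂ true 1) b j) (geo δ b j)) k)

hooked-geo : ∀ b k → P₁₂ true 1 b k ≡ geo (P₁₂ false 1) b k
hooked-geo = fixedPoint-unique (rec-causal (geo δ)) hooked-rec (geo-solves-hooked (P₁₂ false 1) nonhooked-rec)

-- The encoding of the root system of Defs.  Vectors become lists; the
-- positive roots, listed by Defs in the order (i , j), become `roots`.
encode : {n : ℕ} → Root n → LRoot
encode (h , v) = (h , toList v)

toList-step : ∀ n c (x y : ℕ) → c ≤ n → toList (V.tabulate {n = n} (λ t → if toℕ t <ᵇ c then x else y)) ≡ rep c x ++ rep (n ∸ c) y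
toList-step zero    zero    x y z≤n     = refl
toList-step (suc n) zero    x y z≤n     = cong (y ∷_) (toList-step n zero x y z≤n)
toList-step (suc n) (suc c) x y (s≤s c≤n) = cong (x ∷_) (toList-step n c x y c≤n)

highestRoot-list : ∀ n → toList (highestRoot (suc n)) ≡ 1 ∷ rep n 2
highestRoot-list n = cong (1 ∷_) (toList-step n 0 0 2 z≤n)

rootsAt : (n : ℕ) → Fin n → Fin n → List (Root n)
rootsAt n i j = (if toℕ i ≤ᵇ toℕ j then (false , nonhookedCoeffs n i j) ∷ [] else [])
             ++ (if toℕ i <ᵇ toℕ j then (true , hookedCoeffs n i j) ∷ [] else [])

-- Defs enumerates the pairs (i , j) with allFin; splitting off i = 1 leaves
-- a tabulation over the remaining indices.
concatMap-tabulate : ∀ {X Y : Set} n (F : X → List Y) (g : Fin n → X) → concatMap F (L.tabulate g) ≡ concatMap (F ∘ g) (allFin n)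
concatMap-tabulate n F g = cong L.concat (trans (map-tabulate g F) (sym (map-tabulate (λ i → i) (F ∘ g))))

through₁At : ℕ → ℕ → List LRoot
through₁At m j = (false , 1 ∷ rep (suc j) 1 ++ rep (m ∸ suc j) 0) ∷ (true , 1 ∷ rep j 1 ++ rep (m ∸ j) 2) ∷ []

through₁′-enum : ∀ m → through₁′ m ≡ concatMap (through₁At m ∘ toℕ) (allFin m)
through₁′-enum zero    = refl
through₁′-enum (suc m) = cong (λ z → extend (α₁ m) ∷ hook₁₂ m ∷ z)
  (trans (cong (map extend) (through₁′-enum m))
  (trans (map-concatMap extend (through₁At m ∘ toℕ) (allFin m))
         (sym (concatMap-tabulate m (through₁At (suc m) ∘ toℕ) fsuc))))

nonhooked-from₁ : ∀ m (j : Fin (suc m)) → toList (nonhookedCoeffs (suc m) fzero j) ≡ rep (suc (toℕ j)) 1 ++ rep (suc m ∸ suc (toℕ j)) 0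
nonhooked-from₁ m j =
  trans (cong toList (tabulate-cong (λ t → cong (λ b → if b then 1 else 0) (sym (<ᵇ-suc (toℕ t) (toℕ j))))))
        (toList-step (suc m) (suc (toℕ j)) 1 0 (toℕ<n j))

hooked-from₁ : ∀ m (j : Fin m) → toList (hookedCoeffs (suc m) fzero (fsuc j)) ≡ rep (suc (toℕ j)) 1 ++ rep (suc m ∸ suc (toℕ j)) 2
hooked-from₁ m j = toList-step (suc m) (suc (toℕ j)) 1 2 (s≤s (<⇒≤ (toℕ<n j)))

encode-through₁ : ∀ m → map encode (concatMap (rootsAt (suc m) fzero) (allFin (suc m))) ≡ through₁ m
encode-through₁ m = cong₂ _∷_ (cong (false ,_) (nonhooked-from₁ m fzero))
  (trans (map-concatMap encode (rootsAt (suc m) fzero) (L.tabulate fsuc))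
  (trans (concatMap-tabulate m (map encode ∘ rootsAt (suc m) fzero) fsuc)
  (trans (concatMap-cong (λ j → cong₂ (λ a b → (false , a) ∷ (true , b) ∷ []) (nonhooked-from₁ m (fsuc j)) (hooked-from₁ m j)) (allFin m))
         (sym (through₁′-enum m)))))

nonhooked-shift : ∀ m (i j : Fin m) → toList (nonhookedCoeffs (suc m) (fsuc i) (fsuc j)) ≡ 0 ∷ toList (nonhookedCoeffs m i j)
nonhooked-shift m i j =
  cong (0 ∷_) (cong toList (tabulate-cong (λ t → cong (λ b → if b then 1 else 0)
                                                       (cong₂ _∧_ (<ᵇ-suc (toℕ i) (toℕ t)) (<ᵇ-suc (toℕ t) (toℕ j))))))

rootsAt-shift : ∀ m (i j : Fin m) → map encode (rootsAt (suc m) (fsuc i) (fsuc j)) ≡ map shift (map encode (rootsAt m i j))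
rootsAt-shift m i j rewrite <ᵇ-suc (toℕ i) (toℕ j) with toℕ i ≤ᵇ toℕ j | toℕ i <ᵇ toℕ j
... | false | false = refl
... | false | true  = refl
... | true  | false = cong (λ v → (false , v) ∷ []) (nonhooked-shift m i j)
... | true  | true  = cong (λ v → (false , v) ∷ (true , 0 ∷ toList (hookedCoeffs m i j)) ∷ []) (nonhooked-shift m i j)

encode-positiveRoots : ∀ n → map encode (positiveRoots n) ≡ roots n
encode-positiveRoots zero    = refl
encode-positiveRoots (suc m) =
  trans (map-++ encode (F fzero) (concatMap F (L.tabulate fsuc)))
        (cong₂ _++_ (encode-through₁ m) shifted)
  where
  F : Fin (suc m) → List (Root (suc m))
  F i = concatMap (rootsAt (suc m) i) (allFin (suc m))
  row : ∀ i → map encode (F (fsuc i)) ≡ map shift (map encode (concatMap (rootsAt m i) (allFin m)))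
  row i = trans (map-concatMap encode (rootsAt (suc m) (fsuc i)) (L.tabulate fsuc))
          (trans (concatMap-tabulate m (map encode ∘ rootsAt (suc m) (fsuc i)) fsuc)
          (trans (concatMap-cong (rootsAt-shift m i) (allFin m))
          (trans (sym (map-concatMap shift (map encode ∘ rootsAt m i) (allFin m)))
                 (cong (map shift) (sym (map-concatMap encode (rootsAt m i) (allFin m)))))))
  shifted : map encode (concatMap F (L.tabulate fsuc)) ≡ map shift (roots m)
  shifted = trans (map-concatMap encode F (L.tabulate fsuc))
            (trans (concatMap-tabulate m (map encode ∘ F) fsuc)
            (trans (concatMap-cong row (allFin m))
            (trans (sym (map-concatMap shift (λ i → map encode (concatMap (rootsAt m i) (allFin m))) (allFin m)))
                   (cong (map shift) (trans (sym (map-concatMap encode (λ i → concatMap (rootsAt m i) (allFin m)) (allFin m)))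
                                            (encode-positiveRoots m))))))

length-filter-filter : ∀ {X : Set} (p q : X → Bool) xs → length (filterᵇ p (filterᵇ q xs)) ≡ ∑ (λ x → bit (q x ∧ p x)) xs
length-filter-filter p q []       = refl
length-filter-filter p q (x ∷ xs) with q x
... | false = length-filter-filter p q xs
... | true  with p x
...   | false = length-filter-filter p q xs
...   | true  = cong suc (length-filter-filter p q xs)

toList-rootSum : ∀ n (M : List (Root n)) → toList (rootSum M) ≡ sumC n (map encode M)
toList-rootSum n []            = toList-replicate n 0
toList-rootSum n ((h , v) ∷ M) = trans (toList-zipWith v (rootSum M)) (cong (addC (toList v)) (toList-rootSum n M))
  where
  toList-zipWith : ∀ {n} (u w : Vec ℕ n) → toList (zipWith _+_ u w) ≡ addC (toList u) (toList w)
  toList-zipWith V.[]       V.[]       = refl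
  toList-zipWith (a V.∷ u) (b V.∷ w) = cong (a + b ∷_) (toList-zipWith u w)

vecEq-eqC : ∀ {n} (u w : Vec ℕ n) → vecEqᵇ u w ≡ eqCᵇ (toList u) (toList w)
vecEq-eqC V.[]       V.[]       = refl
vecEq-eqC (a V.∷ u) (b V.∷ w) = cong ((a ≡ᵇ b) ∧_) (vecEq-eqC u w)

hasHooked-encode : ∀ {n} (M : List (Root n)) → hasHooked M ≡ hasHookᵇ (map encode M)
hasHooked-encode []            = refl
hasHooked-encode ((h , v) ∷ M) = cong (h ∨_) (hasHooked-encode M)

count-partitions : ∀ n k (p : List (Root n) → Bool) (h : Bool) → (∀ M → p M ≡ matches h (hasHooked M)) →
  length (filterᵇ p (partitions n k)) ≡ count n (toList (highestRoot n)) h k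
count-partitions n k p h p≡h = begin
  length (filterᵇ p (partitions n k))
    ≡⟨ length-filter-filter p (λ M → vecEqᵇ (rootSum M) (highestRoot n)) (multisets (positiveRoots n) k) ⟩
  ∑ (λ M → bit (vecEqᵇ (rootSum M) (highestRoot n) ∧ p M)) (multisets (positiveRoots n) k)
    ≡⟨ ∑-cong (λ M → cong bit (cong₂ _∧_ (sum≡ M) (trans (p≡h M) (cong (matches h) (hasHooked-encode M))))) (multisets (positiveRoots n) k) ⟩
  ∑ (indicator n (toList (highestRoot n)) h ∘ map encode) (multisets (positiveRoots n) k)
    ≡⟨ ∑-map (indicator n (toList (highestRoot n)) h) (map encode) (multisets (positiveRoots n) k) ⟨
  ∑ (indicator n (toList (highestRoot n)) h) (map (map encode) (multisets (positiveRoots n) k))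
    ≡⟨ cong (∑ (indicator n (toList (highestRoot n)) h))
            (trans (sym (multisets-map encode (positiveRoots n) k)) (cong (λ z → multisets z k) (encode-positiveRoots n))) ⟩
  count n (toList (highestRoot n)) h k
    ∎
  where
  open ≡-Reasoning
  sum≡ : ∀ M → vecEqᵇ (rootSum M) (highestRoot n) ≡ eqCᵇ (sumC n (map encode M)) (toList (highestRoot n))
  sum≡ M = trans (vecEq-eqC (rootSum M) (highestRoot n)) (cong (λ z → eqCᵇ z (toList (highestRoot n))) (toList-rootSum n M))

-- The polynomials of Defs have integer coefficients; only from here on are
-- integers needed (importing them earlier would make `+_` ambiguous with
-- sections of ℕ-addition).
open import Data.Integer using (+_) renaming (_+_ to _+ℤ_; _-_ to _-ℤ_; _*_ to _*ℤ_)
open import Data.Integer.Properties using (pos-*; [+m]-[+n]≡m⊖n; ⊖-≥)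

PNH-count : ∀ b k → PNH (suc b) k ≡ + P₁₂ false 1 b k
PNH-count b k = cong +_ (trans (count-partitions (suc b) k noHooked false (λ _ → refl))
                               (cong (λ t → count (suc b) t false k) (highestRoot-list b)))

PH-count : ∀ b k → PH (suc b) k ≡ + P₁₂ true 1 b k
PH-count b k = cong +_ (trans (count-partitions (suc b) k hasHooked true (λ _ → refl))
                              (cong (λ t → count (suc b) t true k) (highestRoot-list b)))

sumFrom-from : ∀ a len (F : ℕ → Poly) (X : Seq) → (∀ i k → F (suc i) k ≡ + X i k) →
  ∀ k → sumFrom (suc a) len F k ≡ + from a len X k
sumFrom-from a zero      F X F≡X k = refl
sumFrom-from a (suc len) F X F≡X k = cong₂ _+ℤ_ (F≡X a k) (sumFrom-from (suc a) len F X F≡X k)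

q²·-q·q· : ∀ (G : Poly) (g : Polyℕ) → (∀ k → G k ≡ + g k) → ∀ k → q²· G k ≡ + (q· q· g) k
q²·-q·q· G g G≡g zero          = refl
q²·-q·q· G g G≡g (suc zero)    = refl
q²·-q·q· G g G≡g (suc (suc k)) = G≡g k

qP-q·δ : ∀ k → qP k ≡ + (q· δ 0) k
qP-q·δ zero          = refl
qP-q·δ (suc zero)    = refl
qP-q·δ (suc (suc k)) = refl

+-∸-ℤ : ∀ x z → + x ≡ + (x + z) -ℤ + z
+-∸-ℤ x z = sym (trans ([+m]-[+n]≡m⊖n (x + z) z) (trans (⊖-≥ (m≤n+m z x)) (cong +_ (m+n∸n≡m x z))))

-- The sums of the statement, in terms of NH = P₁₂ false 1 (P^{NH} shifted by one rank).
NH : Seq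
NH = P₁₂ false 1

PNH-sum : ∀ r k → Σ[ 2 ⋯ suc (suc r) ] PNH k ≡ + Σ< (λ i → NH (suc i)) (suc r) k
PNH-sum r k = trans (sumFrom-from 1 (suc r) PNH NH PNH-count k)
                    (cong +_ (trans (from-shift 0 (suc r) NH k) (from-Σ< (suc r) (λ i → NH (suc i)) k)))

PNH-double-sum : ∀ r k → Σ[ 1 ⋯ suc r ] (λ i → Σ[ 1 ⋯ i ] PNH) k ≡ + Σ< (Σ< NH) (suc (suc r)) k
PNH-double-sum r k =
  trans (sumFrom-from 0 (suc r) (λ i → Σ[ 1 ⋯ i ] PNH) (λ i → Σ< NH (suc i)) inner k)
        (cong +_ (trans (sym (from-shift 0 (suc r) (Σ< NH) k)) (from-Σ< (suc (suc r)) (Σ< NH) k)))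
  where
  inner : ∀ i k → Σ[ 1 ⋯ suc i ] PNH k ≡ + Σ< NH (suc i) k
  inner i k = trans (sumFrom-from 0 (suc i) PNH NH PNH-count k) (cong +_ (from-Σ< (suc i) NH k))

-- Proposition 3.7.  P^H_{B_r} = geo NH at rank r - 1 (hooked-geo), and
-- geo-identity evaluates it; the sums are matched by PNH-sum and PNH-double-sum.
proposition3p7 : (r : ℕ) → 3 ≤ r → (k : ℕ) →
    PH r k ≡ ((qP ⊕ ((+ 2) · Σ[ 2 ⋯ r ∸ 1 ] PNH)) ⊖ q²· (Σ[ 1 ⋯ r ∸ 2 ] (λ i → Σ[ 1 ⋯ i ] PNH))) k
proposition3p7 (suc (suc (suc r))) (s≤s (s≤s (s≤s _))) k = begin
  PH (3 + r) k
    ≡⟨ PH-count (2 + r) k ⟩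
  + P₁₂ true 1 (2 + r) k
    ≡⟨ cong +_ (hooked-geo (2 + r) k) ⟩
  + geo NH (2 + r) k
    ≡⟨ +-∸-ℤ (geo NH (2 + r) k) (q²ΣΣ k) ⟩
  + (geo NH (2 + r) k + q²ΣΣ k) -ℤ + q²ΣΣ k
    ≡⟨ cong (λ z → + z -ℤ + q²ΣΣ k) (geo-identity NH nonhooked-rec (suc r) k) ⟩
  + ((q· δ 0) k + 2 * Σ< (λ i → NH (suc i)) (suc r) k) -ℤ + q²ΣΣ k
    ≡⟨ cong₂ _-ℤ_ (cong₂ _+ℤ_ (sym (qP-q·δ k)) (trans (pos-* 2 (Σ< (λ i → NH (suc i)) (suc r) k)) (cong (+ 2 *ℤ_) (sym (PNH-sum r k)))))
                  (sym (q²·-q·q· _ (Σ< (Σ< NH) (2 + r)) (PNH-double-sum r) k)) ⟩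
  ((qP ⊕ ((+ 2) · Σ[ 2 ⋯ 2 + r ] PNH)) ⊖ q²· (Σ[ 1 ⋯ 1 + r ] (λ i → Σ[ 1 ⋯ i ] PNH))) k
    ∎
  where
  open ≡-Reasoning
  q²ΣΣ : Polyℕ
  q²ΣΣ = q· q· Σ< (Σ< NH) (2 + r)
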